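{- Let $S=(S^-,\mathcal F)$ and $T=(T^-,\mathcal F)$ be recursive causal multiteams of the same signature $\sigma$ with $S\sim T$, and let $\mathbf X=\mathbf x$ be a consistent conjunction. Then $S_{\mathbf X=\mathbf x}\sim T_{\mathbf X=\mathbf x}$.
   Context: A signature $\sigma=(Dom,Ran)$: a finite set $Dom$ of variables, each $X$ with a finite range $Ran(X)$; $\mathbf W_Y$ is the tuple of variables of $Dom\setminus\{Y\}$ in a fixed order. An assignment of signature $\sigma$ is a map $s$ on $Dom$ with $s(X)\in Ran(X)$; $\mathbb B_\sigma$ is the set of these. A multiteam is a finite set $T^-$ of maps $t$ on $Dom\cup\{Key\}$ ($Key$ extra, $\mathbb N$-valued) whose restriction to $Dom$ lies in $\mathbb B_\sigma$; $\#(s,T^-)$ is the number of $t\in T^-$ with $t\upharpoonright Dom=s$. A causal multiteam $T=(T^-,\mathcal F)$: $\mathcal F$ assigns to each $Y$ in a set $\mathbf V\subseteq Dom$ of endogenous variables a non-constant $\mathcal F_Y:Ran(\mathbf W_Y)\to Ran(Y)$ with $t(Y)=\mathcal F_Y(t(\mathbf W_Y))$ for all $t\in T^-$; it is recursive if the graph with $X\to Y$ when $\mathcal F_Y$ depends non-trivially on $X$ is acyclic. Interventions: a conjunction $\mathbf X=\mathbf x$ ($X_1=x_1\land\dots\land X_n=x_n$) is consistent if it has no conjuncts $X=x$, $X=x'$ with $x\neq x'$; then $T_{\mathbf X=\mathbf x}$ has function component $\mathcal F\upharpoonright(\mathbf V\setminus\mathbf X)$ and multiteam $\{t_{\mathbf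 X=\mathbf x}:t\in T^-\}$, where $t_{\mathbf X=\mathbf x}$ agrees with $t$ on $Key$ and exogenous variables outside $\mathbf X$, equals $x_i$ on $X_i$, and $t_{\mathbf X=\mathbf x}(V)=\mathcal F_V(t_{\mathbf X=\mathbf x}(\mathbf W_V))$ recursively for endogenous $V\notin\mathbf X$. Rescaling: $S=(S^-,\mathcal F)$ and $T=(T^-,\mathcal G)$ satisfy $S\sim T$ if $\mathcal F=\mathcal G$ and either $S^-=T^-=\emptyset$ or $\#(s,S^-)/|S^-|=\#(s,T^-)/|T^-|$ for all $s\in\mathbb B_\sigma$. -}

module Defs where

open import Data.Nat using (ℕ; zero; suc; _+_; NonZero)
open import Data.Fin using (Fin; zero; suc; _≟_)
open import Data.Fin.Properties using (all?)
open import Data.Integer using (+_)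
open import Data.Rational using (ℚ; _/_)
open import Data.Maybe using (Maybe; just; nothing)
open import Data.Bool using (if_then_else_)
open import Data.Product using (Σ; ∃; _×_; _,_; proj₁; proj₂)
open import Data.Sum using (_⊎_)
open import Data.List using (List)
open import Data.List.Relation.Unary.Any using (Any; any?)
open import Data.List.Membership.Propositional using (_∈_)
open import Relation.Binary.PropositionalEquality using (_≡_; _≢_)
open import Relation.Binary.Construct.Closure.Transitive using (TransClosure)
open import Relation.Nullary using (¬_; does)

-- Signatures: Dom = Fin n (fixed order = the order of Fin n),
-- Ran(X) = Fin (ran X).

record Signature : Set where
  field
    size : ℕ
    ran  : Fin size → ℕ
open Signature public

Var : Signature → Set
Var σ = Fin (size σ)

Val : (σ : Signature) → Var σ → Set
Val σ X = Fin (ran σ X)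

Assignment : Signature → Set
Assignment σ = (X : Var σ) → Val σ X

_≐_ : {σ : Signature} → Assignment σ → Assignment σ → Set
_≐_ {σ} s t = (X : Var σ) → s X ≡ t X

Args : (σ : Signature) → Var σ → Set
Args σ Y = (X : Var σ) → X ≢ Y → Val σ X

argsOf : {σ : Signature} → Assignment σ → (Y : Var σ) → Args σ Y
argsOf s Y = λ X _ → s X

Mechanism : (σ : Signature) → Var σ → Set
Mechanism σ Y = Args σ Y → Val σ Y

NonConstant : {σ : Signature} {Y : Var σ} → Mechanism σ Y → Set
NonConstant {σ} {Y} f = Σ (Args σ Y) λ w → Σ (Args σ Y) λ w' → f w ≢ f w'

-- Function components: F Y = just F_Y if Y ∈ V (endogenous), nothing otherwise
FunComp : Signature → Set
FunComp σ = (Y : Var σ) → Maybe (Mechanism σ Y)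

-- Multiteams: finitely many rows; the Key of a row is its index
-- (distinct rows have distinct Key values).

record Multiteam (σ : Signature) : Set where
  constructor mkTeam
  field
    card : ℕ
    row  : Fin card → Assignment σ
open Multiteam public

countFin : (m : ℕ) → (Fin m → Data.Bool.Bool) → ℕ
countFin zero    p = 0
countFin (suc m) p = (if p zero then 1 else 0) + countFin m (λ i → p (suc i))

#[_,_] : {σ : Signature} → Assignment σ → Multiteam σ → ℕ
#[_,_] {σ} s T = countFin (card T) (λ i → does (all? {P = λ X → row T i X ≡ s X} (λ X → row T i X ≟ s X)))

record CausalMultiteam (σ : Signature) : Set where
  constructor mkCausal
  field
    team     : Multiteam σ
    F        : FunComp σ
    nonConst : ∀ Y (f : Mechanism σ Y) → F Y ≡ just f → NonConstant f
    compat   : ∀ (i : Fin (card team)) Y (f : Mechanism σ Y) → F Y ≡ just f →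
               row team i Y ≡ f (argsOf (row team i) Y)
open CausalMultiteam public

DependsOn : {σ : Signature} {Y : Var σ} → Mechanism σ Y → Var σ → Set
DependsOn {σ} {Y} f X =
  Σ (Args σ Y) λ w → Σ (Args σ Y) λ w' →
    ((Z : Var σ) (p : Z ≢ Y) → Z ≢ X → w Z p ≡ w' Z p) × f w ≢ f w'

Edge : {σ : Signature} → FunComp σ → Var σ → Var σ → Set
Edge {σ} F X Y = Σ (Mechanism σ Y) λ f → F Y ≡ just f × DependsOn f X

Recursive : {σ : Signature} → FunComp σ → Set
Recursive {σ} F = (X : Var σ) → ¬ TransClosure (Edge F) X X

Conjunction : Signature → Set
Conjunction σ = List (Σ (Var σ) (Val σ))

Consistent : {σ : Signature} → Conjunction σ → Set
Consistent φ = ∀ {p q} → p ∈ φ → q ∈ φ → proj₁ p ≡ proj₁ q → p ≡ q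

Intervened : {σ : Signature} → Conjunction σ → Var σ → Set
Intervened φ V = Any (λ p → proj₁ p ≡ V) φ

restrictF : {σ : Signature} → FunComp σ → Conjunction σ → FunComp σ
restrictF F φ Y = if does (any? (λ p → proj₁ p ≟ Y) φ) then nothing else F Y

IsIntervenedRow : {σ : Signature} → FunComp σ → Conjunction σ →
                  Assignment σ → Assignment σ → Set
IsIntervenedRow {σ} F φ t u =
  (∀ {p} → p ∈ φ → u (proj₁ p) ≡ proj₂ p) ×
  (∀ V → ¬ Intervened φ V → F V ≡ nothing → u V ≡ t V) ×
  (∀ V (f : Mechanism σ V) → ¬ Intervened φ V → F V ≡ just f → u V ≡ f (argsOf u V))

IsInterventionTeam : {σ : Signature} → CausalMultiteam σ → Conjunction σ → Multiteam σ → Set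
IsInterventionTeam T φ U =
  Σ (card U ≡ card (team T)) λ eq →
    ∀ (i : Fin (card U)) →
      IsIntervenedRow (F T) φ (row (team T) (Data.Fin.cast eq i)) (row U i)

_∼_ : {σ : Signature} → (Multiteam σ × FunComp σ) → (Multiteam σ × FunComp σ) → Set
_∼_ {σ} (S , F) (T , G) =
  F ≡ G ×
  ((card S ≡ 0 × card T ≡ 0) ⊎
   (Σ (NonZero (card S)) λ nzS → Σ (NonZero (card T)) λ nzT →
     (s : Assignment σ) →
       _/_ (+ #[ s , S ]) (card S) {{nzS}} ≡ _/_ (+ #[ s , T ]) (card T) {{nzT}}))

-- In a recursive causal multiteam the intervened row t_{X=x} is uniquely
-- determined by t: if two solutions of the intervention equations disagreed at
-- some V, then V is endogenous and not intervened, so its mechanism sees a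
-- disagreement at one of its causes; following causes backwards in the finite
-- causal graph produces a cycle. Hence S_{X=x} and T_{X=x} are the images of S
-- and T under one function on assignments, and images of multisets with
-- proportional multiplicities have proportional multiplicities.
module Submission where

open import Defs
open import Data.Bool using (Bool; true; false; if_then_else_)
open import Data.Bool.Properties using (T-≡)
open import Function.Base using (_∘_)
open import Function.Bundles using (Equivalence)
import Data.Fin as Fin
open import Data.Fin using (Fin; toℕ; cast; fromℕ; inject₁; _≟_)
open import Data.Fin.Properties
  using (all?; toℕ-injective; toℕ-fromℕ; toℕ-inject₁; toℕ<n; pigeonhole; cast-is-id)
open import Data.Integer using () renaming (+_ to pos)
import Data.Integer.Properties as ℤ
open import Data.List using (List; []; _∷_; _++_; map; concat; replicate; tabulate)
open import Data.List.Properties using (map-++; map-tabulate)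
open import Data.List.Membership.Propositional using (find)
open import Data.List.Membership.Propositional.Properties using (∈-∃++)
open import Data.List.Relation.Unary.All using (All; []; _∷_)
open import Data.List.Relation.Unary.All.Properties using (++⁺; ++⁻; tabulate⁺; concat⁺; replicate⁺)
open import Data.List.Relation.Unary.Any using (Any; any?; here; there)
import Data.List.Relation.Unary.Any.Properties as Any
open import Data.Maybe using (just; nothing)
open import Data.Nat using (ℕ; zero; suc; _+_; _*_; _<ᵇ_; NonZero)
open import Data.Nat.Properties
  using (<⇒<ᵇ; n<1+n; m≤n⇒∃[o]m+o≡n; +-comm; +-assoc; +-cancelˡ-≡; *-zeroʳ; *-suc)
open import Data.Product using (Σ; ∃-syntax; _×_; _,_; proj₁; proj₂; uncurry)
open import Data.Rational using (_/_)
open import Data.Rational.Properties using (fromℚᵘ-cong; normalize-injective-≃)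
open import Data.Rational.Unnormalised using (mkℚᵘ; *≡*)
open import Data.Sum using (_⊎_; inj₁; inj₂)
open import Level using (Level; 0ℓ; _⊔_)
open import Relation.Binary using (Rel; DecSetoid; DecidableEquality)
open import Relation.Binary.Construct.Closure.Transitive using (TransClosure; [_]; _∷_)
open import Relation.Binary.PropositionalEquality
  using (_≡_; _≢_; refl; sym; trans; cong; cong₂; subst; module ≡-Reasoning)
open import Relation.Nullary using (yes; no; does; contradiction)
open import Relation.Unary using (Pred)

private
  variable
    a b ℓ ℓ₁ ℓ₂ : Level

module _ {n : ℕ} {R : Rel (Fin n) ℓ} (P : Pred (Fin n) ℓ₁)
         (predecessor : ∀ {x} → P x → ∃[ y ] P y × R y x) where

  private
    descendFrom : ∀ {x} → P x → ℕ → Σ (Fin n) P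
    descendFrom Px zero    = _ , Px
    descendFrom Px (suc k) = let y , Py , _ = predecessor (proj₂ (descendFrom Px k)) in y , Py

    chain : ∀ {x} → P x → ℕ → Fin n
    chain Px k = proj₁ (descendFrom Px k)

    descent : ∀ {x} (Px : P x) d k → TransClosure R (chain Px (suc d + k)) (chain Px k)
    descent Px zero    k = [ proj₂ (proj₂ (predecessor (proj₂ (descendFrom Px k)))) ]
    descent Px (suc d) k =
      proj₂ (proj₂ (predecessor (proj₂ (descendFrom Px (suc d + k))))) ∷ descent Px d k

  predecessor-closed⇒cycle : ∀ {x} → P x → ∃[ z ] TransClosure R z z
  predecessor-closed⇒cycle Px
    with i , j , i<j , zᵢ≡zⱼ ← pigeonhole (n<1+n n) (λ (k : Fin (suc n)) → chain Px (toℕ k))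
    with d , i+1+d≡j ← m≤n⇒∃[o]m+o≡n i<j
    = chain Px (toℕ j)
    , subst (TransClosure R _) zᵢ≡zⱼ (subst (λ m → TransClosure R (chain Px m) _) j≡ (descent Px d (toℕ i)))
    where
    j≡ : suc d + toℕ i ≡ toℕ j
    j≡ = trans (cong suc (+-comm d (toℕ i))) i+1+d≡j

step-change : {A : Set a} → DecidableEquality A → (g : ℕ → A) (n : ℕ) → g 0 ≢ g n →
              ∃[ k ] g (toℕ {n} k) ≢ g (suc (toℕ k))
step-change _≟_ g zero    g₀≢gₙ = contradiction refl g₀≢gₙ
step-change _≟_ g (suc n) g₀≢gₙ₊₁ with g 0 ≟ g n
... | yes g₀≡gₙ =
  fromℕ n , subst (λ m → g m ≢ g (suc m)) (sym (toℕ-fromℕ n)) (λ gₙ≡gₙ₊₁ → g₀≢gₙ₊₁ (trans g₀≡gₙ gₙ≡gₙ₊₁))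
... | no  g₀≢gₙ with k , gₖ≢gₖ₊₁ ← step-change _≟_ g n g₀≢gₙ =
  inject₁ k , subst (λ m → g m ≢ g (suc m)) (sym (toℕ-inject₁ k)) gₖ≢gₖ₊₁

m<ᵇm≡false : ∀ m → (m <ᵇ m) ≡ false
m<ᵇm≡false zero    = refl
m<ᵇm≡false (suc m) = m<ᵇm≡false m

m<ᵇ1+m≡true : ∀ m → (m <ᵇ suc m) ≡ true
m<ᵇ1+m≡true zero    = refl
m<ᵇ1+m≡true (suc m) = m<ᵇ1+m≡true m

m≢n⇒m<ᵇn≡m<ᵇ1+n : ∀ {m n} → m ≢ n → (m <ᵇ n) ≡ (m <ᵇ suc n)
m≢n⇒m<ᵇn≡m<ᵇ1+n {zero}  {zero}  m≢n = contradiction refl m≢n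
m≢n⇒m<ᵇn≡m<ᵇ1+n {zero}  {suc n} m≢n = refl
m≢n⇒m<ᵇn≡m<ᵇ1+n {suc m} {zero}  m≢n = refl
m≢n⇒m<ᵇn≡m<ᵇ1+n {suc m} {suc n} m≢n = m≢n⇒m<ᵇn≡m<ᵇ1+n (λ m≡n → m≢n (cong suc m≡n))

splice : {σ : Signature} → Assignment σ → Assignment σ → ℕ → Assignment σ
splice s t k X = if toℕ X <ᵇ k then t X else s X

module _ {σ : Signature} {Y : Var σ} (f : Mechanism σ Y)
         (f-ext : ∀ {w w'} → (∀ Z p → w Z p ≡ w' Z p) → f w ≡ f w')
         (s t : Assignment σ) where

  private
    g : ℕ → Val σ Y
    g k = f (argsOf (splice s t k) Y)

    g-end : g (size σ) ≡ f (argsOf t Y)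
    g-end = f-ext (λ Z _ → cong (if_then t Z else s Z) (Equivalence.to T-≡ (<⇒<ᵇ (toℕ<n Z))))

    splices-agree : ∀ {X} Z → Z ≢ X → splice s t (toℕ X) Z ≡ splice s t (suc (toℕ X)) Z
    splices-agree Z Z≢X =
      cong (if_then t Z else s Z) (m≢n⇒m<ᵇn≡m<ᵇ1+n (λ Z≡X → Z≢X (toℕ-injective Z≡X)))

    same-at⇒splices-equal : ∀ X → s X ≡ t X → ∀ Z → splice s t (toℕ X) Z ≡ splice s t (suc (toℕ X)) Z
    same-at⇒splices-equal X sX≡tX Z with Z ≟ X
    ... | no  Z≢X  = splices-agree Z Z≢X
    ... | yes refl rewrite m<ᵇm≡false (toℕ X) | m<ᵇ1+m≡true (toℕ X) = sX≡tX

  -- Walking from s to t one variable at a time, the value of f changes at some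
  -- step; the variable switched at that step is a cause.
  change⇒dependency : f (argsOf s Y) ≢ f (argsOf t Y) → ∃[ X ] s X ≢ t X × DependsOn f X
  change⇒dependency fs≢ft
    with X , gₓ≢gₓ₊₁ ← step-change _≟_ g (size σ) (λ g₀≡gₙ → fs≢ft (trans g₀≡gₙ g-end))
    = X , (λ sX≡tX → gₓ≢gₓ₊₁ (f-ext (λ Z _ → same-at⇒splices-equal X sX≡tX Z)))
        , _ , _ , (λ Z _ → splices-agree Z) , gₓ≢gₓ₊₁

module _ {σ : Signature} {F : FunComp σ} (recursive : Recursive F) where

  -- Disagreeing arguments that agree pointwise would make Y a cause of itself.
  mechanism-ext : ∀ {Y} {f : Mechanism σ Y} → F Y ≡ just f →
                  ∀ {w w'} → (∀ Z p → w Z p ≡ w' Z p) → f w ≡ f w'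
  mechanism-ext {Y} {f} FY≡f {w} {w'} w≗w' with f w ≟ f w'
  ... | yes fw≡fw' = fw≡fw'
  ... | no  fw≢fw' = contradiction [ f , FY≡f , w , w' , (λ Z p _ → w≗w' Z p) , fw≢fw' ] (recursive Y)

  module _ {φ : Conjunction σ} {t t' u u' : Assignment σ}
           (u-sol : IsIntervenedRow F φ t u) (u'-sol : IsIntervenedRow F φ t' u') (t≐t' : t ≐ t') where

    private
      Disagree : Var σ → Set
      Disagree V = u V ≢ u' V

      disagreement-cause : ∀ {V} → Disagree V → ∃[ X ] Disagree X × Edge F X V
      disagreement-cause {V} uV≢u'V with any? (λ p → proj₁ p ≟ V) φ
      ... | yes intervened with _ , p∈φ , refl ← find intervened =
        contradiction (trans (proj₁ u-sol p∈φ) (sym (proj₁ u'-sol p∈φ))) uV≢u'V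
      ... | no notIntervened with F V in FV≡
      ...   | nothing = contradiction
                          (trans (proj₁ (proj₂ u-sol) V notIntervened FV≡)
                            (trans (t≐t' V) (sym (proj₁ (proj₂ u'-sol) V notIntervened FV≡))))
                          uV≢u'V
      ...   | just f
        with X , uX≢u'X , f-dep ← change⇒dependency f (mechanism-ext FV≡) u u'
               (λ fu≡fu' → uV≢u'V (trans (proj₂ (proj₂ u-sol) V f notIntervened FV≡)
                                    (trans fu≡fu' (sym (proj₂ (proj₂ u'-sol) V f notIntervened FV≡)))))
        = X , uX≢u'X , f , refl , f-dep

    intervenedRow-unique : u ≐ u'
    intervenedRow-unique V with u V ≟ u' V
    ... | yes uV≡u'V = uV≡u'V
    ... | no  uV≢u'V with z , z⇝z ← predecessor-closed⇒cycle Disagree disagreement-cause uV≢u'V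
      = contradiction z⇝z (recursive z)

module Occurrences (A : DecSetoid a ℓ) where
  open DecSetoid A using (Carrier; _≈_)
    renaming (_≟_ to _≈?_; refl to ≈-refl; sym to ≈-sym; trans to ≈-trans)

  indicator : Carrier → Carrier → ℕ
  indicator y x = if does (y ≈? x) then 1 else 0

  occ : Carrier → List Carrier → ℕ
  occ x []       = 0
  occ x (y ∷ ys) = indicator y x + occ x ys

  indicator-respˡ : ∀ {y y'} x → y ≈ y' → indicator y x ≡ indicator y' x
  indicator-respˡ {y} {y'} x y≈y' with y ≈? x | y' ≈? x
  ... | yes _   | yes _    = refl
  ... | no  _   | no  _    = refl
  ... | yes y≈x | no  y'≉x = contradiction (≈-trans (≈-sym y≈y') y≈x) y'≉x
  ... | no  y≉x | yes y'≈x = contradiction (≈-trans y≈y' y'≈x) y≉x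

  occ-++ : ∀ x xs ys → occ x (xs ++ ys) ≡ occ x xs + occ x ys
  occ-++ x []       ys = refl
  occ-++ x (y ∷ xs) ys = trans (cong (indicator y x +_) (occ-++ x xs ys)) (sym (+-assoc (indicator y x) _ _))

  occ-map-middle : ∀ {B : Set b} (f : B → Carrier) x xs y ys →
                   occ x (map f (xs ++ y ∷ ys)) ≡ indicator (f y) x + occ x (map f (xs ++ ys))
  occ-map-middle f x xs y ys = begin
    occ x (map f (xs ++ y ∷ ys))                       ≡⟨ cong (occ x) (map-++ f xs (y ∷ ys)) ⟩
    occ x (map f xs ++ f y ∷ map f ys)                 ≡⟨ occ-++ x (map f xs) _ ⟩
    occ x (map f xs) + (fy + occ x (map f ys))         ≡⟨ sym (+-assoc (occ x (map f xs)) _ _) ⟩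
    occ x (map f xs) + fy + occ x (map f ys)           ≡⟨ cong (_+ occ x (map f ys)) (+-comm (occ x (map f xs)) _) ⟩
    fy + occ x (map f xs) + occ x (map f ys)           ≡⟨ +-assoc fy _ _ ⟩
    fy + (occ x (map f xs) + occ x (map f ys))         ≡⟨ cong (fy +_) (sym (occ-++ x (map f xs) _)) ⟩
    fy + occ x (map f xs ++ map f ys)                  ≡⟨ cong (λ zs → fy + occ x zs) (sym (map-++ f xs ys)) ⟩
    fy + occ x (map f (xs ++ ys))                      ∎
    where
    open ≡-Reasoning
    fy = indicator (f y) x

  occ-head≢0 : ∀ x xs → occ x (x ∷ xs) ≢ 0
  occ-head≢0 x xs with x ≈? x
  ... | yes _   = λ ()
  ... | no  x≉x = contradiction ≈-refl x≉x

  occ≢0⇒any : ∀ x xs → occ x xs ≢ 0 → Any (_≈ x) xs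
  occ≢0⇒any x []       occ≢0 = contradiction refl occ≢0
  occ≢0⇒any x (y ∷ xs) occ≢0 with y ≈? x
  ... | yes y≈x = here y≈x
  ... | no  _   = there (occ≢0⇒any x xs occ≢0)

  occ-map-concat-replicate : ∀ {B : Set b} (f : B → Carrier) x k ps →
                             occ x (map f (concat (replicate k ps))) ≡ occ x (map f ps) * k
  occ-map-concat-replicate f x zero    ps = sym (*-zeroʳ (occ x (map f ps)))
  occ-map-concat-replicate f x (suc k) ps = begin
    occ x (map f (ps ++ concat (replicate k ps)))              ≡⟨ cong (occ x) (map-++ f ps _) ⟩
    occ x (map f ps ++ map f (concat (replicate k ps)))        ≡⟨ occ-++ x (map f ps) _ ⟩
    occ x (map f ps) + occ x (map f (concat (replicate k ps))) ≡⟨ cong (occ x (map f ps) +_) (occ-map-concat-replicate f x k ps) ⟩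
    occ x (map f ps) + occ x (map f ps) * k                    ≡⟨ sym (*-suc (occ x (map f ps)) k) ⟩
    occ x (map f ps) * suc k                                   ∎
    where open ≡-Reasoning

  occ-tabulate : ∀ {n} x (g : Fin n → Carrier) → occ x (tabulate g) ≡ countFin n (λ i → does (g i ≈? x))
  occ-tabulate {zero}  x g = refl
  occ-tabulate {suc n} x g = cong (indicator (g Fin.zero) x +_) (occ-tabulate x (λ i → g (Fin.suc i)))

module FunctionalMarginals (A : DecSetoid a ℓ₁) (B : DecSetoid b ℓ₂)
         (R : DecSetoid.Carrier A → DecSetoid.Carrier B → Set ℓ)
         (functional : ∀ {x x' y y'} → R x y → R x' y' → DecSetoid._≈_ A x x' → DecSetoid._≈_ B y y')
         where

  module OA = Occurrences A
  module OB = Occurrences B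
  open DecSetoid A using (Carrier) renaming (sym to ≈-sym)
  open DecSetoid B using () renaming (Carrier to Carrierᴮ)

  Graph : List (Carrier × Carrierᴮ) → Set (a ⊔ b ⊔ ℓ)
  Graph = All (uncurry R)

  equal-marginals : ∀ ps qs → Graph ps → Graph qs →
                    (∀ x → OA.occ x (map proj₁ ps) ≡ OA.occ x (map proj₁ qs)) →
                    ∀ y → OB.occ y (map proj₂ ps) ≡ OB.occ y (map proj₂ qs)
  equal-marginals []       []       _          _   _    y = refl
  equal-marginals []       (q ∷ qs) _          _   same y =
    contradiction (sym (same (proj₁ q))) (OA.occ-head≢0 (proj₁ q) (map proj₁ qs))
  equal-marginals (p ∷ ps) qs       (Rp ∷ Rps) Rqs same y
    with q , q∈qs , q≈p ← find (Any.map⁻ (OA.occ≢0⇒any (proj₁ p) (map proj₁ qs)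
           (λ occ≡0 → OA.occ-head≢0 (proj₁ p) (map proj₁ ps) (trans (same (proj₁ p)) occ≡0))))
    with qs₁ , qs₂ , refl ← ∈-∃++ q∈qs
    with Rqs₁ , Rq ∷ Rqs₂ ← ++⁻ qs₁ Rqs
    = begin
      OB.indicator (proj₂ p) y + OB.occ y (map proj₂ ps)
        ≡⟨ cong (_+ _) (OB.indicator-respˡ y (functional Rp Rq (≈-sym q≈p))) ⟩
      OB.indicator (proj₂ q) y + OB.occ y (map proj₂ ps)
        ≡⟨ cong (_ +_) (equal-marginals ps (qs₁ ++ qs₂) Rps (++⁺ Rqs₁ Rqs₂) same′ y) ⟩
      OB.indicator (proj₂ q) y + OB.occ y (map proj₂ (qs₁ ++ qs₂))
        ≡⟨ OB.occ-map-middle proj₂ y qs₁ q qs₂ ⟨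
      OB.occ y (map proj₂ (qs₁ ++ q ∷ qs₂))
        ∎
    where
    open ≡-Reasoning
    same′ : ∀ x → OA.occ x (map proj₁ ps) ≡ OA.occ x (map proj₁ (qs₁ ++ qs₂))
    same′ x = +-cancelˡ-≡ (OA.indicator (proj₁ p) x) _ _ (begin
      OA.indicator (proj₁ p) x + OA.occ x (map proj₁ ps)           ≡⟨ same x ⟩
      OA.occ x (map proj₁ (qs₁ ++ q ∷ qs₂))                         ≡⟨ OA.occ-map-middle proj₁ x qs₁ q qs₂ ⟩
      OA.indicator (proj₁ q) x + OA.occ x (map proj₁ (qs₁ ++ qs₂)) ≡⟨ cong (_+ _) (OA.indicator-respˡ x q≈p) ⟩
      OA.indicator (proj₁ p) x + OA.occ x (map proj₁ (qs₁ ++ qs₂)) ∎)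

  -- Replicating ps n times and qs m times reduces proportionality to equality.
  proportional-marginals : ∀ {m n} ps qs → Graph ps → Graph qs →
                           (∀ x → OA.occ x (map proj₁ ps) * n ≡ OA.occ x (map proj₁ qs) * m) →
                           ∀ y → OB.occ y (map proj₂ ps) * n ≡ OB.occ y (map proj₂ qs) * m
  proportional-marginals {m} {n} ps qs Rps Rqs proportional y = begin
    OB.occ y (map proj₂ ps) * n         ≡⟨ sym (OB.occ-map-concat-replicate proj₂ y n ps) ⟩
    OB.occ y (map proj₂ (ps ^ n))       ≡⟨ equal-marginals (ps ^ n) (qs ^ m) (replicated n Rps) (replicated m Rqs)
                                                           same y ⟩
    OB.occ y (map proj₂ (qs ^ m))       ≡⟨ OB.occ-map-concat-replicate proj₂ y m qs ⟩
    OB.occ y (map proj₂ qs) * m         ∎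
    where
    open ≡-Reasoning
    _^_ : List (Carrier × Carrierᴮ) → ℕ → List (Carrier × Carrierᴮ)
    rs ^ k = concat (replicate k rs)
    replicated : ∀ k {rs} → Graph rs → Graph (rs ^ k)
    replicated k Rrs = concat⁺ (replicate⁺ k Rrs)
    same : ∀ x → OA.occ x (map proj₁ (ps ^ n)) ≡ OA.occ x (map proj₁ (qs ^ m))
    same x = trans (OA.occ-map-concat-replicate proj₁ x n ps)
               (trans (proportional x) (sym (OA.occ-map-concat-replicate proj₁ x m qs)))

≐-decSetoid : Signature → DecSetoid 0ℓ 0ℓ
≐-decSetoid σ = record
  { Carrier          = Assignment σ
  ; _≈_              = _≐_
  ; isDecEquivalence = record
    { isEquivalence = record
      { refl  = λ _ → refl
      ; sym   = λ s≐t X → sym (s≐t X)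
      ; trans = λ s≐t t≐u X → trans (s≐t X) (t≐u X)
      }
    ; _≟_ = λ s t → all? (λ X → s X ≟ t X)
    }
  }

countFin-cong : ∀ {m} {p q : Fin m → Bool} → (∀ i → p i ≡ q i) → countFin m p ≡ countFin m q
countFin-cong {zero}  p≗q = refl
countFin-cong {suc m} p≗q =
  cong₂ _+_ (cong (if_then 1 else 0) (p≗q Fin.zero)) (countFin-cong (λ i → p≗q (Fin.suc i)))

countFin-cast : ∀ {m n} (m≡n : m ≡ n) (p : Fin n → Bool) →
                countFin m (λ i → p (cast m≡n i)) ≡ countFin n p
countFin-cast refl p = countFin-cong (λ i → cong p (cast-is-id refl i))

rowPairs : {σ : Signature} (S U : Multiteam σ) → card U ≡ card S → List (Assignment σ × Assignment σ)
rowPairs S U U≡S = tabulate (λ i → row S (cast U≡S i) , row U i)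

module _ {σ : Signature} (S U : Multiteam σ) (U≡S : card U ≡ card S) where
  open Occurrences (≐-decSetoid σ)
  open DecSetoid (≐-decSetoid σ) using () renaming (_≟_ to _≈?_)

  private
    pairs : Fin (card U) → Assignment σ × Assignment σ
    pairs i = row S (cast U≡S i) , row U i

  occ-proj₁-rowPairs : ∀ s → occ s (map proj₁ (rowPairs S U U≡S)) ≡ #[ s , S ]
  occ-proj₁-rowPairs s = begin
    occ s (map proj₁ (rowPairs S U U≡S))                 ≡⟨ cong (occ s) (map-tabulate pairs proj₁) ⟩
    occ s (tabulate (row S ∘ cast U≡S))                  ≡⟨ occ-tabulate s (row S ∘ cast U≡S) ⟩
    countFin (card U) (λ i → does (row S (cast U≡S i) ≈? s)) ≡⟨ countFin-cast U≡S (λ i → does (row S i ≈? s)) ⟩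
    #[ s , S ]                                            ∎
    where open ≡-Reasoning

  occ-proj₂-rowPairs : ∀ s → occ s (map proj₂ (rowPairs S U U≡S)) ≡ #[ s , U ]
  occ-proj₂-rowPairs s = trans (cong (occ s) (map-tabulate pairs proj₂)) (occ-tabulate s (row U))

module _ {σ : Signature} {R : Assignment σ → Assignment σ → Set ℓ}
         (functional : ∀ {t t' u u'} → R t u → R t' u' → t ≐ t' → u ≐ u') where
  open FunctionalMarginals (≐-decSetoid σ) (≐-decSetoid σ) R functional

  image-*≡* : {S T U U' : Multiteam σ} (U≡S : card U ≡ card S) (U'≡T : card U' ≡ card T) →
              (∀ i → R (row S (cast U≡S i)) (row U i)) → (∀ i → R (row T (cast U'≡T i)) (row U' i)) →
              (∀ r → #[ r , S ] * card T ≡ #[ r , T ] * card S) →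
              ∀ s → #[ s , U ] * card U' ≡ #[ s , U' ] * card U
  image-*≡* {S} {T} {U} {U'} U≡S U'≡T U-rows U'-rows S∝T s = begin
    #[ s , U ] * card U'                   ≡⟨ cong₂ _*_ (occ-proj₂-rowPairs S U U≡S s) (sym U'≡T) ⟨
    OB.occ s (map proj₂ ps) * card T       ≡⟨ proportional-marginals ps qs (tabulate⁺ U-rows) (tabulate⁺ U'-rows)
                                                                     ps∝qs s ⟩
    OB.occ s (map proj₂ qs) * card S       ≡⟨ cong₂ _*_ (occ-proj₂-rowPairs T U' U'≡T s) (sym U≡S) ⟩
    #[ s , U' ] * card U                   ∎
    where
    open ≡-Reasoning
    ps qs : List (Assignment σ × Assignment σ)
    ps = rowPairs S U U≡S
    qs = rowPairs T U' U'≡T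

    ps∝qs : ∀ r → OA.occ r (map proj₁ ps) * card T ≡ OA.occ r (map proj₁ qs) * card S
    ps∝qs r = begin
      OA.occ r (map proj₁ ps) * card T ≡⟨ cong (_* card T) (occ-proj₁-rowPairs S U U≡S r) ⟩
      #[ r , S ] * card T              ≡⟨ S∝T r ⟩
      #[ r , T ] * card S              ≡⟨ cong (_* card S) (occ-proj₁-rowPairs T U' U'≡T r) ⟨
      OA.occ r (map proj₁ qs) * card S ∎

*≡*⇒/≡/ : ∀ a b m n .{{_ : NonZero m}} .{{_ : NonZero n}} → a * n ≡ b * m → pos a / m ≡ pos b / n
*≡*⇒/≡/ a b (suc m) (suc n) an≡bm = fromℚᵘ-cong {mkℚᵘ (pos a) m} {mkℚᵘ (pos b) n}
  (*≡* (trans (sym (ℤ.pos-* a (suc n))) (trans (cong pos an≡bm) (ℤ.pos-* b (suc m)))))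

-- Definitionally the second component of the rescaling relation _∼_.
Proportional : {σ : Signature} → Multiteam σ → Multiteam σ → Set
Proportional {σ} S T =
  (card S ≡ 0 × card T ≡ 0) ⊎
  (Σ (NonZero (card S)) λ nzS → Σ (NonZero (card T)) λ nzT →
    (s : Assignment σ) →
      _/_ (pos #[ s , S ]) (card S) {{nzS}} ≡ _/_ (pos #[ s , T ]) (card T) {{nzT}})

module _ {σ : Signature} where

  Proportional⇒*≡* : {S T : Multiteam σ} → Proportional S T →
                     ∀ s → #[ s , S ] * card T ≡ #[ s , T ] * card S
  Proportional⇒*≡* {S} {T} (inj₁ (S≡0 , T≡0)) s =
    trans (vanishes #[ s , S ] T≡0) (sym (vanishes #[ s , T ] S≡0))
    where
    vanishes : ∀ a {m} → m ≡ 0 → a * m ≡ 0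
    vanishes a refl = *-zeroʳ a
  Proportional⇒*≡* {S} {T} (inj₂ (nzS , nzT , S∝T)) s =
    normalize-injective-≃ #[ s , S ] #[ s , T ] (card S) (card T) {{nzS}} {{nzT}} (S∝T s)

  Proportional-transport : {S T U U' : Multiteam σ} → card U ≡ card S → card U' ≡ card T →
                           Proportional S T →
                           (∀ s → #[ s , U ] * card U' ≡ #[ s , U' ] * card U) → Proportional U U'
  Proportional-transport U≡S U'≡T (inj₁ (S≡0 , T≡0)) _ = inj₁ (trans U≡S S≡0 , trans U'≡T T≡0)
  Proportional-transport {U = U} {U'} U≡S U'≡T (inj₂ (nzS , nzT , _)) U∝U' =
    inj₂ (nzU , nzU' , λ s → *≡*⇒/≡/ #[ s , U ] #[ s , U' ] (card U) (card U') {{nzU}} {{nzU'}}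
                                      (U∝U' s))
    where
    nzU : NonZero (card U)
    nzU = subst NonZero (sym U≡S) nzS
    nzU' : NonZero (card U')
    nzU' = subst NonZero (sym U'≡T) nzT

mainTheorem10 : {σ : Signature} (S T : CausalMultiteam σ) →
    F S ≡ F T → Recursive (F S) → Recursive (F T) →
    (team S , F S) ∼ (team T , F T) →
    (φ : Conjunction σ) → Consistent φ →
    (U U' : Multiteam σ) → IsInterventionTeam S φ U → IsInterventionTeam T φ U' →
    (U , restrictF (F S) φ) ∼ (U' , restrictF (F T) φ)
mainTheorem10 S T FS≡FT recursive _ (_ , S∝T) φ _ U U' (U≡S , U-rows) (U'≡T , U'-rows) =
  cong (λ G → restrictF G φ) FS≡FT ,
  Proportional-transport U≡S U'≡T S∝T
    (image-*≡* (intervenedRow-unique recursive) U≡S U'≡T U-rows U'-rows-for-F-S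
               (Proportional⇒*≡* S∝T))
  where
  U'-rows-for-F-S : ∀ i → IsIntervenedRow (F S) φ (row (team T) (cast U'≡T i)) (row U' i)
  U'-rows-for-F-S i = subst (λ G → IsIntervenedRow G φ _ _) (sym FS≡FT) (U'-rows i)
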